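{- Let $p,r$ be natural numbers with $0<r<p$ and $\gcd(r,2p)=1$, let $n\ge 0$ be an integer, and put $N=2pn+r(p-r)$. For integers $k,l$ let $Q_{r,p}(k,l)=\frac{p(k^2-l^2)}{2}+\frac{p(k+l)}{2}-lr$. Let $A_0(n)$ (resp. $A_1(n)$) be the number of pairs $(k,l)\in\mathbb{Z}^2$ with $k\ge |l|$, $n=Q_{r,p}(k,l)$ and $k+l\equiv 0\pmod 2$ (resp. $k+l\equiv 1\pmod 2$). Then $D_{r,2p}(N)=D_{ -r,2p}(N)$ if and only if either $n$ is not of the form $Q_{r,p}(k,l)$ with $k,l\in\mathbb{Z}$, $k\ge|l|$, or $A_0(n)=A_1(n)$. Moreover, $D_{r,2p}(N)>D_{ -r,2p}(N)$ if $A_0(n)>A_1(n)$, and $D_{r,2p}(N)<D_{ -r,2p}(N)$ if $A_0(n)<A_1(n)$.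
   Context: For positive integers $N,m$ and an integer $s$, $D_{s,m}(N)$ denotes the number of positive divisors $d$ of $N$ with $d\equiv s\pmod m$. -}

module Defs where

open import Data.Nat as ℕ using (ℕ; zero; suc)
open import Data.Nat.Divisibility using (_∣?_)
open import Data.Integer as ℤ using (ℤ; +_; ∣_∣)
open import Data.Integer.DivMod using (_/ℕ_; _%ℕ_)
open import Data.List using (List; length; filter; applyUpTo; upTo; concatMap; map)
open import Data.Product using (_×_; _,_; proj₁; proj₂)
open import Relation.Nullary.Decidable using (_×-dec_)
import Data.Nat.Properties as ℕP
import Data.Integer.Properties as ℤP

-- D s m N : number of positive divisors d of N with d ≡ s (mod m),
-- i.e. m divides the integer d - s.  For N ≥ 1 every positive divisor is ≤ N,
-- so we enumerate d = 1, …, N.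
D : ℤ → ℕ → ℕ → ℕ
D s m N = length (filter (λ d → (d ∣? N) ×-dec (m ∣? ∣ + d ℤ.- s ∣)) (applyUpTo suc N))

-- Q_{r,p}(k,l) = p(k²-l²)/2 + p(k+l)/2 - l r.
-- The numerator p(k²-l²) + p(k+l) = p(k+l)(k-l+1) is always even,
-- so the division by 2 is exact.
Q : ℕ → ℕ → ℤ → ℤ → ℤ
Q r p k l = ((+ p ℤ.* (k ℤ.* k ℤ.- l ℤ.* l) ℤ.+ + p ℤ.* (k ℤ.+ l)) /ℕ 2) ℤ.- l ℤ.* + r

box : ℕ → List (ℤ × ℤ)
box B = concatMap (λ k → map (λ i → (+ k , + i ℤ.- + k)) (upTo (suc (k ℕ.+ k)))) (upTo (suc B))

-- Every such pair with 0 < r < p satisfies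
-- k ≤ 2n (with a = k+l, b = k-l ≥ 0 one has 2n = a(pb+p-r) + rb, so
-- a ≤ 2n and b ≤ 2n), hence it suffices to enumerate the box with B = 2n.
A : ℕ → ℕ → ℕ → ℕ → ℕ
A j r p n = length (filter (λ kl → (Q r p (proj₁ kl) (proj₂ kl) ℤP.≟ + n)
                                   ×-dec ((proj₁ kl ℤ.+ proj₂ kl) %ℕ 2 ℕP.≟ j))
                           (box (2 ℕ.* n)))

module Submission where

-- Put q = p − r and, for k ≥ |l|, a = k + l and b = k − l, so that a ≡ b (mod 2). Then
-- 2 Q_{r,p}(k,l) = p a b + a q + b r, and p (p a b + a q + b r) + r q = (p a + r)(p b + q),
-- so n = Q_{r,p}(k,l) exactly when N = (p a + r)(p b + q). For a, b even the factor p a + r is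
-- ≡ r (mod 2p); for a, b odd the factor p b + q is ≡ −r (mod 2p). Conversely, as gcd(r, 2p) = 1,
-- a divisor d ≡ r (mod 2p) of N is p a + r with a even, its cofactor is ≡ q (mod p), i.e. of the
-- form p b + q, and 2n = a (p b + q) + b r forces b to be even as well; divisors ≡ −r (mod 2p)
-- are handled symmetrically. Hence A₀(n) = D_{r,2p}(N) and A₁(n) = D_{−r,2p}(N), and both
-- A's vanish when n has no representation.

open import Defs
open import Data.Nat as ℕ using (ℕ; zero; suc; _+_; _*_; _∸_; _<_; _>_; _≤_; NonZero)
open import Data.Nat.GCD using (gcd)
open import Data.Integer as ℤ using (ℤ; +_; -_; ∣_∣)
open import Data.Product using (Σ; _×_; _,_; proj₁; proj₂; ∃)
open import Data.Sum using (_⊎_; inj₁; inj₂; [_,_])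
open import Relation.Nullary using (¬_; yes; no; contradiction)
open import Relation.Binary.PropositionalEquality
  using (_≡_; _≢_; refl; sym; trans; cong; cong₂; subst; subst₂; module ≡-Reasoning)
open import Function.Bundles using (_⇔_; mk⇔; Equivalence)

import Data.Nat.Properties as ℕ
import Data.Nat.Tactic.RingSolver as ℕ-Ring
open import Data.Nat.DivMod using (_%_; m≡m%n+[m/n]*n; [m+kn]%n≡m%n)
open import Data.Nat.Divisibility
  using (_∣_; _∣?_; divides; _∣0; ∣-refl; ∣-trans; 0∣⇒≡0; ∣1⇒≡1; ∣⇒≤; m∣m*n; n∣m*n; *-monoʳ-∣;
         ∣m∣n⇒∣m+n; ∣m+n∣m⇒∣n; n∣m⇒m%n≡0; m%n≡0⇒n∣m)
open import Data.Nat.Coprimality using (Coprime; coprime-divisor; gcd≡1⇒coprime)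
import Data.Integer.Properties as ℤ
import Data.Integer.Tactic.RingSolver as ℤ-Ring
open import Data.Integer.DivMod using (_%ℕ_; _/ℕ_; a≡a%ℕn+[a/ℕn]*n)

open import Data.List using (List; length; filter; map; upTo; applyUpTo)
open import Data.List.Properties using (length-map; filter-none)
open import Data.List.Membership.Propositional using (_∈_; find; lose)
open import Data.List.Membership.Propositional.Properties
  using (∈-map⁺; ∈-map⁻; ∈-filter⁺; ∈-filter⁻; ∈-concatMap⁺; ∈-concatMap⁻;
         ∈-upTo⁺; ∈-upTo⁻; ∈-applyUpTo⁺)
open import Data.List.Membership.Propositional.Properties.WithK using (unique∧set⇒bag)
open import Data.List.Relation.Binary.BagAndSetEquality using (∼bag⇒↭)
open import Data.List.Relation.Binary.Permutation.Propositional.Properties using (↭-length)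
open import Data.List.Relation.Binary.Disjoint.Propositional using (Disjoint)
import Data.List.Relation.Unary.All as All
import Data.List.Relation.Unary.All.Properties as All
open import Data.List.Relation.Unary.Any using (here; there)
import Data.List.Relation.Unary.AllPairs as AllPairs
import Data.List.Relation.Unary.AllPairs.Properties as AllPairs
open import Data.List.Relation.Unary.Unique.Propositional using (Unique; []; _∷_)
import Data.List.Relation.Unary.Unique.Propositional.Properties as Unique
open import Level using (0ℓ)
open import Relation.Nullary.Decidable using (_×-dec_)
open import Relation.Unary using (Pred; Decidable)

-- Counting along a bijection

module _ {A B : Set} (f : A → B) where

  Unique-map⁺ : ∀ {xs} → Unique xs → (∀ {x y} → x ∈ xs → y ∈ xs → f x ≡ f y → x ≡ y) →
                Unique (map f xs)
  Unique-map⁺ []           _   = []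
  Unique-map⁺ (x∉ ∷ !xs) inj =
    All.map⁺ (All.tabulate λ y∈ fx≡fy → All.lookup x∉ y∈ (inj (here refl) (there y∈) fx≡fy))
    ∷ Unique-map⁺ !xs (λ x∈ y∈ → inj (there x∈) (there y∈))

  length-≡-bijection : ∀ {xs ys} → Unique xs → Unique ys →
    (∀ {x} → x ∈ xs → f x ∈ ys) →
    (∀ {x y} → x ∈ xs → y ∈ xs → f x ≡ f y → x ≡ y) →
    (∀ {y} → y ∈ ys → ∃ λ x → x ∈ xs × f x ≡ y) →
    length xs ≡ length ys
  length-≡-bijection {xs} {ys} !xs !ys into inj onto =
    trans (sym (length-map f xs))
          (↭-length (∼bag⇒↭ (unique∧set⇒bag (Unique-map⁺ !xs inj) !ys (mk⇔ to from))))
    where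
    to : ∀ {y} → y ∈ map f xs → y ∈ ys
    to y∈ with ∈-map⁻ f y∈
    ... | x , x∈ , refl = into x∈
    from : ∀ {y} → y ∈ ys → y ∈ map f xs
    from y∈ with onto y∈
    ... | x , x∈ , refl = ∈-map⁺ f x∈

module _ {A B : Set} {P : Pred A 0ℓ} {R : Pred B 0ℓ} (P? : Decidable P) (R? : Decidable R)
         (f : A → B) where

  length-filter-≡-bijection : ∀ {xs ys} → Unique xs → Unique ys →
    (∀ {x} → x ∈ xs → P x → f x ∈ ys × R (f x)) →
    (∀ {x y} → x ∈ xs → P x → y ∈ xs → P y → f x ≡ f y → x ≡ y) →
    (∀ {y} → y ∈ ys → R y → ∃ λ x → (x ∈ xs × P x) × f x ≡ y) →
    length (filter P? xs) ≡ length (filter R? ys)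
  length-filter-≡-bijection !xs !ys into inj onto =
    length-≡-bijection f (Unique.filter⁺ P? !xs) (Unique.filter⁺ R? !ys)
      (λ x∈ → let x∈xs , px = ∈-filter⁻ P? x∈ ; fx∈ys , rfx = into x∈xs px in ∈-filter⁺ R? fx∈ys rfx)
      (λ x∈ y∈ → let x∈xs , px = ∈-filter⁻ P? x∈ ; y∈xs , py = ∈-filter⁻ P? y∈ in inj x∈xs px y∈xs py)
      (λ y∈ → let y∈ys , ry = ∈-filter⁻ R? y∈ ; x , (x∈xs , px) , fx≡y = onto y∈ys ry in
              x , ∈-filter⁺ P? x∈xs px , fx≡y)

-- Parity

k*2≡k+k : ∀ k → k * 2 ≡ k + k
k*2≡k+k k = trans (ℕ.*-comm k 2) (cong (ℕ._+_ k) (ℕ.+-identityʳ k))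

2∣k+k : ∀ k → 2 ∣ k + k
2∣k+k k = subst (2 ∣_) (k*2≡k+k k) (n∣m*n k)

2∣⇒≡k+k : ∀ {m} → 2 ∣ m → ∃ λ k → m ≡ k + k
2∣⇒≡k+k (divides k m≡k*2) = k , trans m≡k*2 (k*2≡k+k k)

k+k≡k′+k′⇒k≡k′ : ∀ {k k′} → k + k ≡ k′ + k′ → k ≡ k′
k+k≡k′+k′⇒k≡k′ {k} {k′} e = trans (ℕ.n≡⌊n+n/2⌋ k) (trans (cong ℕ.⌊_/2⌋ e) (sym (ℕ.n≡⌊n+n/2⌋ k′)))

2∣n⊎2∣1+n : ∀ n → (2 ∣ n) ⊎ (2 ∣ suc n)
2∣n⊎2∣1+n zero    = inj₁ (2 ∣0)
2∣n⊎2∣1+n (suc n) with 2∣n⊎2∣1+n n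
... | inj₁ 2∣n   = inj₂ (∣m∣n⇒∣m+n (∣-refl {2}) 2∣n)
... | inj₂ 2∣1+n = inj₁ 2∣1+n

2∣n⇒2∤1+n : ∀ {n} → 2 ∣ n → ¬ 2 ∣ suc n
2∣n⇒2∤1+n {n} 2∣n 2∣1+n with ∣1⇒≡1 (∣m+n∣m⇒∣n (subst (2 ∣_) (ℕ.+-comm 1 n) 2∣1+n) 2∣n)
... | ()

2∤n⇒2∣1+n : ∀ {n} → ¬ 2 ∣ n → 2 ∣ suc n
2∤n⇒2∣1+n {n} 2∤n with 2∣n⊎2∣1+n n
... | inj₁ 2∣n   = contradiction 2∣n 2∤n
... | inj₂ 2∣1+n = 2∣1+n

n%2≡1⇔2∣1+n : ∀ n → n % 2 ≡ 1 ⇔ 2 ∣ suc n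
n%2≡1⇔2∣1+n n = mk⇔ to from
  where
  to : n % 2 ≡ 1 → 2 ∣ suc n
  to n%2≡1 = divides (suc (n ℕ./ 2))
    (cong suc (trans (m≡m%n+[m/n]*n n 2) (cong (ℕ._+ n ℕ./ 2 * 2) n%2≡1)))
  from : 2 ∣ suc n → n % 2 ≡ 1
  from (divides (suc k) 1+n≡[1+k]*2) =
    trans (cong (_% 2) (ℕ.suc-injective 1+n≡[1+k]*2)) ([m+kn]%n≡m%n 1 k 2)

2∣m+n⇒2∣1+m⇒2∣1+n : ∀ {m n} → 2 ∣ m + n → 2 ∣ suc m → 2 ∣ suc n
2∣m+n⇒2∣1+m⇒2∣1+n {m} {n} 2∣m+n 2∣1+m =
  ∣m+n∣m⇒∣n (subst (2 ∣_) (sym (cong suc (ℕ.+-suc m n))) (∣m∣n⇒∣m+n (∣-refl {2}) 2∣m+n)) 2∣1+m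

2∣1+m⇒2∣1+n⇒2∣m+n : ∀ {m n} → 2 ∣ suc m → 2 ∣ suc n → 2 ∣ m + n
2∣1+m⇒2∣1+n⇒2∣m+n {m} {n} 2∣1+m 2∣1+n =
  ∣m+n∣m⇒∣n (subst (2 ∣_) (cong suc (ℕ.+-suc m n)) (∣m∣n⇒∣m+n 2∣1+m 2∣1+n)) (∣-refl {2})

2∣m+n⇒2∣m*[1+n] : ∀ {m n} → 2 ∣ m + n → 2 ∣ m * suc n
2∣m+n⇒2∣m*[1+n] {m} {n} 2∣m+n with 2∣n⊎2∣1+n m
... | inj₁ 2∣m   = ∣-trans 2∣m (m∣m*n (suc n))
... | inj₂ 2∣1+m = ∣-trans (2∣m+n⇒2∣1+m⇒2∣1+n 2∣m+n 2∣1+m) (n∣m*n m)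

-- Residues and cofactors

m+n≢0 : ∀ m n .{{_ : NonZero n}} → NonZero (m + n)
m+n≢0 m n = ℕ.>-nonZero (ℕ.<-≤-trans (ℕ.>-nonZero⁻¹ n) (ℕ.m≤n+m n m))

∣+m-+n∣≡∣m-n∣ : ∀ m n → ℤ.∣ + m ℤ.- + n ∣ ≡ ℕ.∣ m - n ∣
∣+m-+n∣≡∣m-n∣ m n with ℕ.≤-total n m
... | inj₁ n≤m = trans (cong ℤ.∣_∣ (trans (ℤ.m-n≡m⊖n m n) (ℤ.⊖-≥ n≤m))) (sym (ℕ.m≤n⇒∣n-m∣≡n∸m n≤m))
... | inj₂ m≤n = begin
  ℤ.∣ + m ℤ.- + n ∣     ≡⟨ cong ℤ.∣_∣ (trans (ℤ.m-n≡m⊖n m n) (ℤ.⊖-≤ m≤n)) ⟩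
  ℤ.∣ - + (n ∸ m) ∣     ≡⟨ ℤ.∣-i∣≡∣i∣ (+ (n ∸ m)) ⟩
  n ∸ m                 ≡⟨ ℕ.m≤n⇒∣m-n∣≡n∸m m≤n ⟨
  ℕ.∣ m - n ∣           ∎
  where open ≡-Reasoning

∣+[m+n]-+n∣≡m : ∀ m n → ℤ.∣ + (m + n) ℤ.- + n ∣ ≡ m
∣+[m+n]-+n∣≡m m n = begin
  ℤ.∣ + (m + n) ℤ.- + n ∣  ≡⟨ ∣+m-+n∣≡∣m-n∣ (m + n) n ⟩
  ℕ.∣ m + n - n ∣          ≡⟨ ℕ.∣-∣-comm (m + n) n ⟩
  ℕ.∣ n - m + n ∣          ≡⟨ cong (λ o → ℕ.∣ n - o ∣) (ℕ.+-comm m n) ⟩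
  ℕ.∣ n - n + m ∣          ≡⟨ ℕ.∣m-m+n∣≡n n m ⟩
  m                        ∎
  where open ≡-Reasoning

∣+m-[-+n]∣≡m+n : ∀ m n → ℤ.∣ + m ℤ.- - + n ∣ ≡ m + n
∣+m-[-+n]∣≡m+n m n =
  cong ℤ.∣_∣ (trans (cong (λ i → + m ℤ.+ i) (ℤ.neg-involutive (+ n))) (sym (ℤ.pos-+ m n)))

m∣∣n-o∣⇒n≡k*m+o : ∀ {m n o} → o < m → m ∣ ℕ.∣ n - o ∣ → ∃ λ k → n ≡ k * m + o
m∣∣n-o∣⇒n≡k*m+o {m} {n} {o} o<m (divides k ∣n-o∣≡k*m) with o ℕ.≤? n
... | yes o≤n = k , (begin
  n                     ≡⟨ ℕ.m∸n+n≡m o≤n ⟨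
  n ∸ o + o             ≡⟨ cong (_+ o) (ℕ.m≤n⇒∣n-m∣≡n∸m o≤n) ⟨
  ℕ.∣ n - o ∣ + o       ≡⟨ cong (_+ o) ∣n-o∣≡k*m ⟩
  k * m + o             ∎)
  where open ≡-Reasoning
... | no o≰n = contradiction (∣⇒≤ ⦃ ℕ.>-nonZero (ℕ.m<n⇒0<n∸m n<o) ⦄ m∣o∸n)
                            (ℕ.<⇒≱ (ℕ.≤-<-trans (ℕ.m∸n≤m o n) o<m))
  where
  n<o : n < o
  n<o = ℕ.≰⇒> o≰n
  m∣o∸n : m ∣ o ∸ n
  m∣o∸n = divides k (trans (sym (ℕ.m≤n⇒∣m-n∣≡n∸m (ℕ.<⇒≤ n<o))) ∣n-o∣≡k*m)

cofactor : ∀ {m s t a c e} → Coprime m s → t < m → (m * a + s) * e ≡ m * c + s * t →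
           ∃ λ b → e ≡ b * m + t
cofactor {m} {s} {t} {a} {c} {e} m⊥s t<m [ma+s]e≡mc+st =
  m∣∣n-o∣⇒n≡k*m+o t<m
    (coprime-divisor m⊥s (divides ℕ.∣ c - a * e ∣ (trans s∣e-t∣≡m∣c-ae∣ (ℕ.*-comm m _))))
  where
  open ≡-Reasoning
  s∣e-t∣≡m∣c-ae∣ : s * ℕ.∣ e - t ∣ ≡ m * ℕ.∣ c - a * e ∣
  s∣e-t∣≡m∣c-ae∣ = begin
    s * ℕ.∣ e - t ∣
      ≡⟨ ℕ.*-distribˡ-∣-∣ s e t ⟩
    ℕ.∣ s * e - s * t ∣
      ≡⟨ ℕ.∣m+n-m+o∣≡∣n-o∣ (m * (a * e)) _ _ ⟨
    ℕ.∣ m * (a * e) + s * e - m * (a * e) + s * t ∣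
      ≡⟨ cong (λ x → ℕ.∣ x - m * (a * e) + s * t ∣) [ma+s]e≡mae+se ⟨
    ℕ.∣ (m * a + s) * e - m * (a * e) + s * t ∣
      ≡⟨ cong (λ x → ℕ.∣ x - m * (a * e) + s * t ∣) [ma+s]e≡mc+st ⟩
    ℕ.∣ m * c + s * t - m * (a * e) + s * t ∣
      ≡⟨ cong₂ ℕ.∣_-_∣ (ℕ.+-comm (m * c) _) (ℕ.+-comm (m * (a * e)) _) ⟩
    ℕ.∣ s * t + m * c - s * t + m * (a * e) ∣
      ≡⟨ ℕ.∣m+n-m+o∣≡∣n-o∣ (s * t) _ _ ⟩
    ℕ.∣ m * c - m * (a * e) ∣
      ≡⟨ ℕ.*-distribˡ-∣-∣ m c (a * e) ⟨
    m * ℕ.∣ c - a * e ∣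
      ∎
    where
    [ma+s]e≡mae+se : (m * a + s) * e ≡ m * (a * e) + s * e
    [ma+s]e≡mae+se = trans (ℕ.*-distribʳ-+ e (m * a) s) (cong (_+ s * e) (ℕ.*-assoc m a e))

∣⇒∈applyUpTo-suc : ∀ {d n} .{{_ : NonZero n}} → d ∣ n → d ∈ applyUpTo suc n
∣⇒∈applyUpTo-suc {zero}  {n} 0∣n = contradiction (0∣⇒≡0 0∣n) (ℕ.≢-nonZero⁻¹ n)
∣⇒∈applyUpTo-suc {suc d}     d∣n = ∈-applyUpTo⁺ suc (∣⇒≤ d∣n)

-- The lattice points enumerated by box

point : ℕ → ℕ → ℤ × ℤ
point k a = (+ k , + a ℤ.- + k)

row : ℕ → List (ℤ × ℤ)
row k = map (point k) (upTo (suc (k + k)))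

sum : ℤ × ℤ → ℤ
sum x = proj₁ x ℤ.+ proj₂ x

difference : ℤ × ℤ → ℤ
difference x = proj₁ x ℤ.- proj₂ x

sum-point : ∀ k a → sum (point k a) ≡ + a
sum-point k a = K+[A-K]≡A (+ k) (+ a)
  where
  K+[A-K]≡A : ∀ K A → K ℤ.+ (A ℤ.- K) ≡ A
  K+[A-K]≡A = ℤ-Ring.solve-∀

difference-point : ∀ k {a b} → a + b ≡ k + k → difference (point k a) ≡ + b
difference-point k {a} {b} a+b≡k+k = begin
  + k ℤ.- (+ a ℤ.- + k)               ≡⟨ K-[A-K]≡K+K-A (+ k) (+ a) ⟩
  (+ k ℤ.+ + k) ℤ.- + a               ≡⟨ cong (ℤ._- + a) (ℤ.pos-+ k k) ⟨
  + (k + k) ℤ.- + a                   ≡⟨ cong (λ m → + m ℤ.- + a) a+b≡k+k ⟨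
  + (a + b) ℤ.- + a                   ≡⟨ cong (ℤ._- + a) (ℤ.pos-+ a b) ⟩
  (+ a ℤ.+ + b) ℤ.- + a               ≡⟨ A+B-A≡B (+ a) (+ b) ⟩
  + b                                 ∎
  where
  open ≡-Reasoning
  K-[A-K]≡K+K-A : ∀ K A → K ℤ.- (A ℤ.- K) ≡ (K ℤ.+ K) ℤ.- A
  K-[A-K]≡K+K-A = ℤ-Ring.solve-∀
  A+B-A≡B : ∀ A B → (A ℤ.+ B) ℤ.- A ≡ B
  A+B-A≡B = ℤ-Ring.solve-∀

row-unique : ∀ k → Unique (row k)
row-unique k = Unique.map⁺ point-injective (Unique.upTo⁺ (suc (k + k)))
  where
  point-injective : ∀ {a a′} → point k a ≡ point k a′ → a ≡ a′
  point-injective {a} {a′} e =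
    ℤ.+-injective (trans (sym (sum-point k a)) (trans (cong sum e) (sum-point k a′)))

∈-row⇒proj₁≡ : ∀ {k x} → x ∈ row k → proj₁ x ≡ + k
∈-row⇒proj₁≡ {k} x∈ with ∈-map⁻ (point k) x∈
... | _ , _ , refl = refl

rows-disjoint : ∀ {k k′} → k ≢ k′ → Disjoint (row k) (row k′)
rows-disjoint k≢k′ (x∈ , x∈′) =
  k≢k′ (ℤ.+-injective (trans (sym (∈-row⇒proj₁≡ x∈)) (∈-row⇒proj₁≡ x∈′)))

box-unique : ∀ B → Unique (box B)
box-unique B = Unique.concat⁺ (All.map⁺ (All.universal row-unique _))
                              (AllPairs.map⁺ (AllPairs.map rows-disjoint (Unique.upTo⁺ (suc B))))

∈-box⁻ : ∀ {B x} → x ∈ box B → ∃ λ k → ∃ λ a → k ≤ B × a ≤ k + k × x ≡ point k a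
∈-box⁻ {B} x∈ with find (∈-concatMap⁻ row {xs = upTo (suc B)} x∈)
... | k , k∈ , x∈row with ∈-map⁻ (point k) x∈row
...   | a , a∈ , x≡ = k , a , ℕ.≤-pred (∈-upTo⁻ k∈) , ℕ.≤-pred (∈-upTo⁻ a∈) , x≡

∈-box⁺ : ∀ {B k a} → k ≤ B → a ≤ k + k → point k a ∈ box B
∈-box⁺ {k = k} k≤B a≤2k =
  ∈-concatMap⁺ row (lose (∈-upTo⁺ (ℕ.s≤s k≤B)) (∈-map⁺ (point k) (∈-upTo⁺ (ℕ.s≤s a≤2k))))

∣a-k∣≤k : ∀ {a k} → a ≤ k + k → ℕ.∣ a - k ∣ ≤ k
∣a-k∣≤k {a} {k} a≤2k with ℕ.∣m-n∣≡[m∸n]∨[n∸m] a k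
... | inj₁ ∣a-k∣≡a∸k = subst (_≤ k) (sym ∣a-k∣≡a∸k) (ℕ.m≤n+o⇒m∸n≤o a k a≤2k)
... | inj₂ ∣a-k∣≡k∸a = subst (_≤ k) (sym ∣a-k∣≡k∸a) (ℕ.m∸n≤m k a)

Representation : ℕ → ℕ → ℕ → Set
Representation r p n = Σ ℤ (λ k → Σ ℤ (λ l → (+ ∣ l ∣ ℤ.≤ k) × (+ n ≡ Q r p k l)))

Class : ℕ → ℕ → ℕ → ℕ → Pred (ℤ × ℤ) 0ℓ
Class j r p n x = Q r p (proj₁ x) (proj₂ x) ≡ + n × sum x %ℕ 2 ≡ j

class? : ∀ j r p n → Decidable (Class j r p n)
class? j r p n x = (Q r p (proj₁ x) (proj₂ x) ℤ.≟ + n) ×-dec (sum x %ℕ 2 ℕ.≟ j)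

A-unrepresented : ∀ j r p n → ¬ Representation r p n → A j r p n ≡ 0
A-unrepresented j r p n ¬rep =
  cong length (filter-none (class? j r p n) (All.tabulate unrepresented))
  where
  unrepresented : ∀ {x} → x ∈ box (2 * n) → ¬ Class j r p n x
  unrepresented x∈ (Q≡n , _) with ∈-box⁻ {2 * n} x∈
  ... | k , a , _ , a≤2k , refl =
    ¬rep (+ k , + a ℤ.- + k , ℤ.+≤+ (subst (_≤ k) (sym (∣+m-+n∣≡∣m-n∣ a k)) (∣a-k∣≤k a≤2k)) ,
          sym Q≡n)

-- Representations of n and divisors of N

-- p is taken to be q + r, so that q = p − r involves no truncated subtraction.
module Correspondence (q r : ℕ) .{{_ : NonZero q}} .{{_ : NonZero r}}
                      (r⊥2p : Coprime r (2 * (q + r))) (n : ℕ) where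

  open ≡-Reasoning

  p : ℕ
  p = q + r

  N : ℕ
  N = 2 * p * n + r * q

  instance
    p≢0 : NonZero p
    p≢0 = m+n≢0 q r
    N≢0 : NonZero N
    N≢0 = m+n≢0 (2 * p * n) (r * q) ⦃ ℕ.m*n≢0 r q ⦄

  form : ℕ → ℕ → ℕ
  form a b = p * a * b + a * q + b * r

  form≡a[pb+q]+br : ∀ a b → form a b ≡ a * (p * b + q) + b * r
  form≡a[pb+q]+br a b = identity q r a b
    where
    identity : ∀ q r a b → (q + r) * a * b + a * q + b * r ≡ a * ((q + r) * b + q) + b * r
    identity = ℕ-Ring.solve-∀

  form≡b[pa+r]+aq : ∀ a b → form a b ≡ b * (p * a + r) + a * q
  form≡b[pa+r]+aq a b = identity q r a b
    where
    identity : ∀ q r a b → (q + r) * a * b + a * q + b * r ≡ b * ((q + r) * a + r) + a * q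
    identity = ℕ-Ring.solve-∀

  N≡p*2n+rq : N ≡ p * (2 * n) + r * q
  N≡p*2n+rq = cong (_+ r * q) (trans (cong (_* n) (ℕ.*-comm 2 p)) (ℕ.*-assoc p 2 n))

  form≡2n⇔ : ∀ {a b} → form a b ≡ 2 * n ⇔ (p * a + r) * (p * b + q) ≡ N
  form≡2n⇔ {a} {b} = mk⇔
    (λ form≡2n → trans (factorisation q r a b)
                       (trans (cong (λ m → p * m + r * q) form≡2n) (sym N≡p*2n+rq)))
    (λ product≡N → ℕ.*-cancelˡ-≡ _ _ p (ℕ.+-cancelʳ-≡ (r * q) _ _
                     (trans (sym (factorisation q r a b)) (trans product≡N N≡p*2n+rq))))
    where
    factorisation : ∀ q r a b → ((q + r) * a + r) * ((q + r) * b + q)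
                              ≡ (q + r) * ((q + r) * a * b + a * q + b * r) + r * q
    factorisation = ℕ-Ring.solve-∀

  form-injectiveˡ : ∀ {a a′} b → form a b ≡ form a′ b → a ≡ a′
  form-injectiveˡ {a} {a′} b e =
    ℕ.*-cancelʳ-≡ a a′ (p * b + q) ⦃ m+n≢0 (p * b) q ⦄
      (ℕ.+-cancelʳ-≡ (b * r) _ _ (trans (sym (form≡a[pb+q]+br a b)) (trans e (form≡a[pb+q]+br a′ b))))

  form-injectiveʳ : ∀ a {b b′} → form a b ≡ form a b′ → b ≡ b′
  form-injectiveʳ a {b} {b′} e =
    ℕ.*-cancelʳ-≡ b b′ (p * a + r) ⦃ m+n≢0 (p * a) r ⦄
      (ℕ.+-cancelʳ-≡ (a * q) _ _ (trans (sym (form≡b[pa+r]+aq a b)) (trans e (form≡b[pa+r]+aq a b′))))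

  a+b≤form : ∀ a b → a + b ≤ form a b
  a+b≤form a b = ℕ.+-mono-≤ (ℕ.≤-trans (ℕ.m≤m*n a q) (ℕ.m≤n+m (a * q) (p * a * b))) (ℕ.m≤m*n b r)

  2∣a⇒2∣b : ∀ {a b} → form a b ≡ 2 * n → 2 ∣ a → 2 ∣ b
  2∣a⇒2∣b {a} {b} form≡2n 2∣a = coprime-divisor 2⊥r (subst (2 ∣_) (ℕ.*-comm b r) 2∣br)
    where
    2⊥r : Coprime 2 r
    2⊥r (d∣2 , d∣r) = r⊥2p (d∣r , ∣-trans d∣2 (m∣m*n p))
    2∣br : 2 ∣ b * r
    2∣br = ∣m+n∣m⇒∣n (subst (2 ∣_) (trans (sym form≡2n) (form≡a[pb+q]+br a b)) (m∣m*n n))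
                     (∣-trans 2∣a (m∣m*n _))

  2∣1+b⇒2∣1+a : ∀ {a b} → form a b ≡ 2 * n → 2 ∣ suc b → 2 ∣ suc a
  2∣1+b⇒2∣1+a form≡2n 2∣1+b = 2∤n⇒2∣1+n (λ 2∣a → 2∣n⇒2∤1+n (2∣a⇒2∣b form≡2n 2∣a) 2∣1+b)

  numerator : ℤ × ℤ → ℤ
  numerator x = + p ℤ.* (proj₁ x ℤ.* proj₁ x ℤ.- proj₂ x ℤ.* proj₂ x) ℤ.+ + p ℤ.* (proj₁ x ℤ.+ proj₂ x)

  numerator≡ : ∀ x → numerator x ≡ + p ℤ.* (sum x ℤ.* (+ 1 ℤ.+ difference x))
  numerator≡ (k , l) = P[K²-L²]+P[K+L]≡P[K+L][1+K-L] (+ p) k l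
    where
    P[K²-L²]+P[K+L]≡P[K+L][1+K-L] : ∀ P K L → P ℤ.* (K ℤ.* K ℤ.- L ℤ.* L) ℤ.+ P ℤ.* (K ℤ.+ L)
                                           ≡ P ℤ.* ((K ℤ.+ L) ℤ.* (+ 1 ℤ.+ (K ℤ.- L)))
    P[K²-L²]+P[K+L]≡P[K+L][1+K-L] = ℤ-Ring.solve-∀

  2Q≡ : ∀ x → numerator x %ℕ 2 ≡ 0 →
        + 2 ℤ.* Q r p (proj₁ x) (proj₂ x)
        ≡ + p ℤ.* sum x ℤ.* difference x ℤ.+ sum x ℤ.* + q ℤ.+ difference x ℤ.* + r
  2Q≡ x@(k , l) numerator-even = begin
    + 2 ℤ.* (numerator x /ℕ 2 ℤ.- l ℤ.* + r)
      ≡⟨ 2[H-LR]≡2H-2LR (numerator x /ℕ 2) l (+ r) ⟩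
    numerator x /ℕ 2 ℤ.* + 2 ℤ.- + 2 ℤ.* l ℤ.* + r
      ≡⟨ cong (ℤ._- + 2 ℤ.* l ℤ.* + r) halve ⟩
    + p ℤ.* (k ℤ.* k ℤ.- l ℤ.* l) ℤ.+ + p ℤ.* (k ℤ.+ l) ℤ.- + 2 ℤ.* l ℤ.* + r
      ≡⟨ cong (λ P → + p ℤ.* (k ℤ.* k ℤ.- l ℤ.* l) ℤ.+ P ℤ.* (k ℤ.+ l) ℤ.- + 2 ℤ.* l ℤ.* + r)
              (ℤ.pos-+ q r) ⟩
    + p ℤ.* (k ℤ.* k ℤ.- l ℤ.* l) ℤ.+ (+ q ℤ.+ + r) ℤ.* (k ℤ.+ l) ℤ.- + 2 ℤ.* l ℤ.* + r
      ≡⟨ regroup (+ p) (+ q) (+ r) k l ⟩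
    + p ℤ.* (k ℤ.+ l) ℤ.* (k ℤ.- l) ℤ.+ (k ℤ.+ l) ℤ.* + q ℤ.+ (k ℤ.- l) ℤ.* + r ∎
    where
    2[H-LR]≡2H-2LR : ∀ H L R → + 2 ℤ.* (H ℤ.- L ℤ.* R) ≡ H ℤ.* + 2 ℤ.- + 2 ℤ.* L ℤ.* R
    2[H-LR]≡2H-2LR = ℤ-Ring.solve-∀
    halve : numerator x /ℕ 2 ℤ.* + 2 ≡ numerator x
    halve = sym (trans (a≡a%ℕn+[a/ℕn]*n (numerator x) 2)
                       (trans (cong (λ m → + m ℤ.+ numerator x /ℕ 2 ℤ.* + 2) numerator-even)
                              (ℤ.+-identityˡ _)))
    regroup : ∀ P Q R K L → P ℤ.* (K ℤ.* K ℤ.- L ℤ.* L) ℤ.+ (Q ℤ.+ R) ℤ.* (K ℤ.+ L) ℤ.- + 2 ℤ.* L ℤ.* R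
                           ≡ P ℤ.* (K ℤ.+ L) ℤ.* (K ℤ.- L) ℤ.+ (K ℤ.+ L) ℤ.* Q ℤ.+ (K ℤ.- L) ℤ.* R
    regroup = ℤ-Ring.solve-∀

  pos-form : ∀ a b → + form a b ≡ + p ℤ.* + a ℤ.* + b ℤ.+ + a ℤ.* + q ℤ.+ + b ℤ.* + r
  pos-form a b = begin
    + (p * a * b + a * q + b * r)
      ≡⟨ ℤ.pos-+ (p * a * b + a * q) (b * r) ⟩
    + (p * a * b + a * q) ℤ.+ + (b * r)
      ≡⟨ cong₂ ℤ._+_ (ℤ.pos-+ (p * a * b) (a * q)) (ℤ.pos-* b r) ⟩
    + (p * a * b) ℤ.+ + (a * q) ℤ.+ + b ℤ.* + r
      ≡⟨ cong₂ (λ x y → x ℤ.+ y ℤ.+ + b ℤ.* + r) pos-pab (ℤ.pos-* a q) ⟩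
    + p ℤ.* + a ℤ.* + b ℤ.+ + a ℤ.* + q ℤ.+ + b ℤ.* + r
      ∎
    where
    pos-pab : + (p * a * b) ≡ + p ℤ.* + a ℤ.* + b
    pos-pab = trans (ℤ.pos-* (p * a) b) (cong (ℤ._* + b) (ℤ.pos-* p a))

  Q≡n⇔form≡2n : ∀ k {a b} → a + b ≡ k + k → Q r p (+ k) (+ a ℤ.- + k) ≡ + n ⇔ form a b ≡ 2 * n
  Q≡n⇔form≡2n k {a} {b} a+b≡k+k = mk⇔
    (λ Q≡n → ℤ.+-injective (trans (sym 2Q≡form) (trans (cong (+ 2 ℤ.*_) Q≡n) (sym (ℤ.pos-* 2 n)))))
    (λ form≡2n → ℤ.*-cancelˡ-≡ (+ 2) _ _ (trans 2Q≡form (trans (cong +_ form≡2n) (ℤ.pos-* 2 n))))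
    where
    x : ℤ × ℤ
    x = point k a
    numerator≡+ : numerator x ≡ + (p * (a * suc b))
    numerator≡+ = begin
      numerator x                                 ≡⟨ numerator≡ x ⟩
      + p ℤ.* (sum x ℤ.* (+ 1 ℤ.+ difference x))  ≡⟨ cong₂ (λ s d → + p ℤ.* (s ℤ.* (+ 1 ℤ.+ d)))
                                                            (sum-point k a) (difference-point k a+b≡k+k) ⟩
      + p ℤ.* (+ a ℤ.* (+ 1 ℤ.+ + b))             ≡⟨ cong (λ d → + p ℤ.* (+ a ℤ.* d)) (ℤ.pos-+ 1 b) ⟨
      + p ℤ.* (+ a ℤ.* + suc b)                   ≡⟨ cong (+ p ℤ.*_) (ℤ.pos-* a (suc b)) ⟨
      + p ℤ.* + (a * suc b)                       ≡⟨ ℤ.pos-* p (a * suc b) ⟨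
      + (p * (a * suc b))                         ∎
    numerator-even : numerator x %ℕ 2 ≡ 0
    numerator-even = trans (cong (_%ℕ 2) numerator≡+) (n∣m⇒m%n≡0 _ 2 (∣-trans 2∣a[1+b] (n∣m*n p)))
      where
      2∣a[1+b] : 2 ∣ a * suc b
      2∣a[1+b] = 2∣m+n⇒2∣m*[1+n] {a} {b} (subst (2 ∣_) (sym a+b≡k+k) (2∣k+k k))
    2Q≡form : + 2 ℤ.* Q r p (+ k) (+ a ℤ.- + k) ≡ + form a b
    2Q≡form = begin
      + 2 ℤ.* Q r p (+ k) (+ a ℤ.- + k)
        ≡⟨ 2Q≡ x numerator-even ⟩
      + p ℤ.* sum x ℤ.* difference x ℤ.+ sum x ℤ.* + q ℤ.+ difference x ℤ.* + r
        ≡⟨ cong₂ (λ s d → + p ℤ.* s ℤ.* d ℤ.+ s ℤ.* + q ℤ.+ d ℤ.* + r)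
                 (sum-point k a) (difference-point k a+b≡k+k) ⟩
      + p ℤ.* + a ℤ.* + b ℤ.+ + a ℤ.* + q ℤ.+ + b ℤ.* + r
        ≡⟨ pos-form a b ⟨
      + form a b ∎

  record Solution (j : ℕ) (x : ℤ × ℤ) : Set where
    field
      k a b   : ℕ
      x≡point : x ≡ point k a
      a+b≡k+k : a + b ≡ k + k
      form≡2n : form a b ≡ 2 * n
      a%2≡j   : a % 2 ≡ j

    2∣a+b : 2 ∣ a + b
    2∣a+b = subst (2 ∣_) (sym a+b≡k+k) (2∣k+k k)

  classify : ∀ {j x} → x ∈ box (2 * n) → Class j r p n x → Solution j x
  classify x∈ (Q≡n , sum%2≡j) with ∈-box⁻ {2 * n} x∈
  ... | k , a , _ , a≤2k , refl = record
    { k = k ; a = a ; b = k + k ∸ a ; x≡point = refl ; a+b≡k+k = a+b≡k+k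
    ; form≡2n = Equivalence.to (Q≡n⇔form≡2n k a+b≡k+k) Q≡n
    ; a%2≡j = trans (cong (_%ℕ 2) (sym (sum-point k a))) sum%2≡j
    }
    where
    a+b≡k+k : a + (k + k ∸ a) ≡ k + k
    a+b≡k+k = ℕ.m+[n∸m]≡n a≤2k

  solution-injective : ∀ {j j′ x y} (s : Solution j x) (t : Solution j′ y) →
                       Solution.a s ≡ Solution.a t → Solution.b s ≡ Solution.b t → x ≡ y
  solution-injective record { k = k ; a = a ; x≡point = refl ; a+b≡k+k = a+b≡k+k }
                     record { k = k′ ; x≡point = refl ; a+b≡k+k = a+b≡k′+k′ } refl refl =
    cong (λ k → point k a) (k+k≡k′+k′⇒k≡k′ (trans (sym a+b≡k+k) a+b≡k′+k′))

  divisors : List ℕ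
  divisors = applyUpTo suc N

  divisors-unique : Unique divisors
  divisors-unique = Unique.applyUpTo⁺₁ suc N (λ i<j _ → ℕ.<⇒≢ (ℕ.s<s i<j))

  Divisor : ℤ → Pred ℕ 0ℓ
  Divisor s d = (d ∣ N) × (2 * p ∣ ℤ.∣ + d ℤ.- s ∣)

  divisor? : ∀ s → Decidable (Divisor s)
  divisor? s d = (d ∣? N) ×-dec ((2 * p) ∣? ℤ.∣ + d ℤ.- s ∣)

  2p∣p*m : ∀ {m} → 2 ∣ m → 2 * p ∣ p * m
  2p∣p*m {m} 2∣m = subst (_∣ p * m) (ℕ.*-comm p 2) (*-monoʳ-∣ p 2∣m)

  r<p : r < p
  r<p = ℕ.m<n+m r (ℕ.>-nonZero⁻¹ q)

  q<p : q < p
  q<p = ℕ.m<m+n q (ℕ.>-nonZero⁻¹ r)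

  p⊥r : Coprime p r
  p⊥r (d∣p , d∣r) = r⊥2p (d∣r , ∣-trans d∣p (n∣m*n 2))

  p⊥q : Coprime p q
  p⊥q (d∣p , d∣q) = p⊥r (d∣p , ∣m+n∣m⇒∣n d∣p d∣q)

  p*b+q+r≡p*[1+b] : ∀ b → p * b + q + r ≡ p * suc b
  p*b+q+r≡p*[1+b] b = identity q r b
    where
    identity : ∀ q r b → (q + r) * b + q + r ≡ (q + r) * suc b
    identity = ℕ-Ring.solve-∀

  d₊ : ℤ × ℤ → ℕ
  d₊ x = p * ℤ.∣ sum x ∣ + r

  d₋ : ℤ × ℤ → ℕ
  d₋ x = p * ℤ.∣ difference x ∣ + q

  d₊-point : ∀ k a → d₊ (point k a) ≡ p * a + r
  d₊-point k a = cong (λ i → p * ℤ.∣ i ∣ + r) (sum-point k a)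

  d₋-point : ∀ k {a b} → a + b ≡ k + k → d₋ (point k a) ≡ p * b + q
  d₋-point k a+b≡k+k = cong (λ i → p * ℤ.∣ i ∣ + q) (difference-point k a+b≡k+k)

  d₊-solution : ∀ {j x} (s : Solution j x) → d₊ x ≡ p * Solution.a s + r
  d₊-solution record { k = k ; a = a ; x≡point = refl } = d₊-point k a

  d₋-solution : ∀ {j x} (s : Solution j x) → d₋ x ≡ p * Solution.b s + q
  d₋-solution record { k = k ; x≡point = refl ; a+b≡k+k = a+b≡k+k } = d₋-point k a+b≡k+k

  d₊-into : ∀ {x} → x ∈ box (2 * n) → Class 0 r p n x → d₊ x ∈ divisors × Divisor (+ r) (d₊ x)
  d₊-into {x} x∈ x-class = subst (λ d → d ∈ divisors × Divisor (+ r) d) (sym (d₊-solution s))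
                             (∣⇒∈applyUpTo-suc d∣N , d∣N , 2p∣d-r)
    where
    s : Solution 0 x
    s = classify x∈ x-class
    open Solution s
    d∣N : p * a + r ∣ N
    d∣N = divides (p * b + q) (trans (sym (Equivalence.to form≡2n⇔ form≡2n)) (ℕ.*-comm (p * a + r) _))
    2p∣d-r : 2 * p ∣ ℤ.∣ + (p * a + r) ℤ.- + r ∣
    2p∣d-r = subst (2 * p ∣_) (sym (∣+[m+n]-+n∣≡m (p * a) r)) (2p∣p*m (m%n≡0⇒n∣m a 2 a%2≡j))

  d₋-into : ∀ {x} → x ∈ box (2 * n) → Class 1 r p n x → d₋ x ∈ divisors × Divisor (- + r) (d₋ x)
  d₋-into {x} x∈ x-class = subst (λ e → e ∈ divisors × Divisor (- + r) e) (sym (d₋-solution s))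
                             (∣⇒∈applyUpTo-suc e∣N , e∣N , 2p∣e+r)
    where
    s : Solution 1 x
    s = classify x∈ x-class
    open Solution s
    e∣N : p * b + q ∣ N
    e∣N = divides (p * a + r) (sym (Equivalence.to form≡2n⇔ form≡2n))
    2∣1+b : 2 ∣ suc b
    2∣1+b = 2∣m+n⇒2∣1+m⇒2∣1+n 2∣a+b (Equivalence.to (n%2≡1⇔2∣1+n a) a%2≡j)
    2p∣e+r : 2 * p ∣ ℤ.∣ + (p * b + q) ℤ.- - + r ∣
    2p∣e+r = subst (2 * p ∣_) (sym (trans (∣+m-[-+n]∣≡m+n (p * b + q) r) (p*b+q+r≡p*[1+b] b)))
                   (2p∣p*m 2∣1+b)

  d₊-injective : ∀ {x y} → x ∈ box (2 * n) → Class 0 r p n x → y ∈ box (2 * n) → Class 0 r p n y →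
                 d₊ x ≡ d₊ y → x ≡ y
  d₊-injective {x} {y} x∈ x-class y∈ y-class d₊x≡d₊y = solution-injective s t a≡a′ b≡b′
    where
    s : Solution 0 x
    s = classify x∈ x-class
    t : Solution 0 y
    t = classify y∈ y-class
    open Solution s
    open Solution t renaming (a to a′; b to b′; form≡2n to form′≡2n)
    a≡a′ : a ≡ a′
    a≡a′ = ℕ.*-cancelˡ-≡ a a′ p (ℕ.+-cancelʳ-≡ r _ _
             (trans (sym (d₊-solution s)) (trans d₊x≡d₊y (d₊-solution t))))
    b≡b′ : b ≡ b′
    b≡b′ = form-injectiveʳ a (trans form≡2n (trans (sym form′≡2n) (cong (λ a → form a b′) (sym a≡a′))))

  d₋-injective : ∀ {x y} → x ∈ box (2 * n) → Class 1 r p n x → y ∈ box (2 * n) → Class 1 r p n y →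
                 d₋ x ≡ d₋ y → x ≡ y
  d₋-injective {x} {y} x∈ x-class y∈ y-class d₋x≡d₋y = solution-injective s t a≡a′ b≡b′
    where
    s : Solution 1 x
    s = classify x∈ x-class
    t : Solution 1 y
    t = classify y∈ y-class
    open Solution s
    open Solution t renaming (a to a′; b to b′; form≡2n to form′≡2n)
    b≡b′ : b ≡ b′
    b≡b′ = ℕ.*-cancelˡ-≡ b b′ p (ℕ.+-cancelʳ-≡ q _ _
             (trans (sym (d₋-solution s)) (trans d₋x≡d₋y (d₋-solution t))))
    a≡a′ : a ≡ a′
    a≡a′ = form-injectiveˡ b (trans form≡2n (trans (sym form′≡2n) (cong (form a′) (sym b≡b′))))

  solution⇒point : ∀ {j a b} → form a b ≡ 2 * n → 2 ∣ a + b → a % 2 ≡ j →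
    ∃ λ x → (x ∈ box (2 * n) × Class j r p n x) × d₊ x ≡ p * a + r × d₋ x ≡ p * b + q
  solution⇒point {a = a} {b} form≡2n 2∣a+b a%2≡j with 2∣⇒≡k+k 2∣a+b
  ... | k , a+b≡k+k =
    point k a ,
    (∈-box⁺ k≤2n (subst (a ≤_) a+b≡k+k (ℕ.m≤m+n a b)) ,
     Equivalence.from (Q≡n⇔form≡2n k a+b≡k+k) form≡2n ,
     trans (cong (_%ℕ 2) (sum-point k a)) a%2≡j) ,
    d₊-point k a , d₋-point k a+b≡k+k
    where
    k≤2n : k ≤ 2 * n
    k≤2n = ℕ.≤-trans (ℕ.m≤m+n k k) (subst₂ _≤_ a+b≡k+k form≡2n (a+b≤form a b))

  r<2p : r < 2 * p
  r<2p = ℕ.<-≤-trans r<p (ℕ.m≤m+n p (p + 0))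

  2p∣y-r⇒y≡pa+r : ∀ {y} → 2 * p ∣ ℤ.∣ + y ℤ.- + r ∣ → ∃ λ a → 2 ∣ a × y ≡ p * a + r
  2p∣y-r⇒y≡pa+r {y} 2p∣y-r with m∣∣n-o∣⇒n≡k*m+o r<2p (subst (2 * p ∣_) (∣+m-+n∣≡∣m-n∣ y r) 2p∣y-r)
  ... | u , y≡u*2p+r = u * 2 , divides u refl , trans y≡u*2p+r (cong (_+ r) (u*[2*p]≡p*[u*2] u p))
    where
    u*[2*p]≡p*[u*2] : ∀ u p → u * (2 * p) ≡ p * (u * 2)
    u*[2*p]≡p*[u*2] = ℕ-Ring.solve-∀

  2p∣y+r⇒y≡pb+q : ∀ {y} → 2 * p ∣ ℤ.∣ + y ℤ.- - + r ∣ → ∃ λ b → 2 ∣ suc b × y ≡ p * b + q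
  2p∣y+r⇒y≡pb+q {y} 2p∣y+r with subst (2 * p ∣_) (∣+m-[-+n]∣≡m+n y r) 2p∣y+r
  ... | divides zero    y+r≡0          = contradiction (ℕ.m+n≡0⇒n≡0 y y+r≡0) (ℕ.≢-nonZero⁻¹ r)
  ... | divides (suc v) y+r≡[1+v]*2p =
    suc (v * 2) , divides (suc v) refl ,
    ℕ.+-cancelʳ-≡ r _ _
      (trans y+r≡[1+v]*2p (trans ([1+v]*[2*p]≡p*[2+v*2] v p) (sym (p*b+q+r≡p*[1+b] _))))
    where
    [1+v]*[2*p]≡p*[2+v*2] : ∀ v p → suc v * (2 * p) ≡ p * suc (suc (v * 2))
    [1+v]*[2*p]≡p*[2+v*2] = ℕ-Ring.solve-∀

  cofactor₊ : ∀ {a} → p * a + r ∣ N → ∃ λ b → form a b ≡ 2 * n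
  cofactor₊ {a} (divides e N≡e*d)
    with cofactor p⊥r q<p (trans (ℕ.*-comm (p * a + r) e) (trans (sym N≡e*d) N≡p*2n+rq))
  ... | b , e≡b*p+q = b , Equivalence.from form≡2n⇔ (begin
    (p * a + r) * (p * b + q)  ≡⟨ cong (λ m → (p * a + r) * (m + q)) (ℕ.*-comm p b) ⟩
    (p * a + r) * (b * p + q)  ≡⟨ cong ((p * a + r) *_) e≡b*p+q ⟨
    (p * a + r) * e            ≡⟨ ℕ.*-comm (p * a + r) e ⟩
    e * (p * a + r)            ≡⟨ N≡e*d ⟨
    N                          ∎)

  cofactor₋ : ∀ {b} → p * b + q ∣ N → ∃ λ a → form a b ≡ 2 * n
  cofactor₋ {b} (divides d N≡d*e)
    with cofactor p⊥q r<p (begin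
    (p * b + q) * d            ≡⟨ ℕ.*-comm (p * b + q) d ⟩
    d * (p * b + q)            ≡⟨ N≡d*e ⟨
    N                          ≡⟨ N≡p*2n+rq ⟩
    p * (2 * n) + r * q        ≡⟨ cong (ℕ._+_ (p * (2 * n))) (ℕ.*-comm r q) ⟩
    p * (2 * n) + q * r        ∎)
  ... | a , d≡a*p+r = a , Equivalence.from form≡2n⇔ (begin
    (p * a + r) * (p * b + q)  ≡⟨ cong (λ m → (m + r) * (p * b + q)) (ℕ.*-comm p a) ⟩
    (a * p + r) * (p * b + q)  ≡⟨ cong (_* (p * b + q)) d≡a*p+r ⟨
    d * (p * b + q)            ≡⟨ N≡d*e ⟨
    N                          ∎)

  d₊-onto : ∀ {y} → y ∈ divisors → Divisor (+ r) y →
            ∃ λ x → (x ∈ box (2 * n) × Class 0 r p n x) × d₊ x ≡ y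
  d₊-onto {y} _ (y∣N , 2p∣y-r) =
    let a , 2∣a , y≡pa+r    = 2p∣y-r⇒y≡pa+r 2p∣y-r
        b , form≡2n         = cofactor₊ (subst (_∣ N) y≡pa+r y∣N)
        x , x∈ , d₊x≡pa+r , _ = solution⇒point form≡2n (∣m∣n⇒∣m+n 2∣a (2∣a⇒2∣b form≡2n 2∣a))
                                                (n∣m⇒m%n≡0 a 2 2∣a)
    in x , x∈ , trans d₊x≡pa+r (sym y≡pa+r)

  d₋-onto : ∀ {y} → y ∈ divisors → Divisor (- + r) y →
            ∃ λ x → (x ∈ box (2 * n) × Class 1 r p n x) × d₋ x ≡ y
  d₋-onto {y} _ (y∣N , 2p∣y+r) =
    let b , 2∣1+b , y≡pb+q  = 2p∣y+r⇒y≡pb+q 2p∣y+r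
        a , form≡2n         = cofactor₋ (subst (_∣ N) y≡pb+q y∣N)
        2∣1+a               = 2∣1+b⇒2∣1+a form≡2n 2∣1+b
        x , x∈ , _ , d₋x≡pb+q = solution⇒point form≡2n (2∣1+m⇒2∣1+n⇒2∣m+n 2∣1+a 2∣1+b)
                                                (Equivalence.from (n%2≡1⇔2∣1+n a) 2∣1+a)
    in x , x∈ , trans d₋x≡pb+q (sym y≡pb+q)

  A₀≡D₊ : A 0 r p n ≡ D (+ r) (2 * p) N
  A₀≡D₊ = length-filter-≡-bijection (class? 0 r p n) (divisor? (+ r)) d₊
            (box-unique (2 * n)) divisors-unique d₊-into d₊-injective d₊-onto

  A₁≡D₋ : A 1 r p n ≡ D (- + r) (2 * p) N
  A₁≡D₋ = length-filter-≡-bijection (class? 1 r p n) (divisor? (- + r)) d₋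
            (box-unique (2 * n)) divisors-unique d₋-into d₋-injective d₋-onto

A≡D : ∀ {p r} n → 0 < r → r < p → Coprime r (2 * p) →
      let N = 2 * p * n + r * (p ∸ r) in
      A 0 r p n ≡ D (+ r) (2 * p) N × A 1 r p n ≡ D (- (+ r)) (2 * p) N
A≡D {p} {r} n 0<r r<p r⊥2p = subst Counts q+r≡p (A₀≡D₊ , A₁≡D₋)
  where
  q : ℕ
  q = p ∸ r
  q+r≡p : q + r ≡ p
  q+r≡p = ℕ.m∸n+n≡m (ℕ.<⇒≤ r<p)
  Counts : ℕ → Set
  Counts p′ = A 0 r p′ n ≡ D (+ r) (2 * p′) (2 * p′ * n + r * q)
            × A 1 r p′ n ≡ D (- (+ r)) (2 * p′) (2 * p′ * n + r * q)
  open Correspondence q r ⦃ ℕ.>-nonZero (ℕ.m<n⇒0<n∸m r<p) ⦄ ⦃ ℕ.>-nonZero 0<r ⦄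
                      (subst (λ m → Coprime r (2 * m)) (sym q+r≡p) r⊥2p) n

corollary1p1 : (p r n : ℕ) → 0 < r → r < p → gcd r (2 * p) ≡ 1 →
    let N = 2 * p * n + r * (p ∸ r) in
    ((D (+ r) (2 * p) N ≡ D (- (+ r)) (2 * p) N)
       ⇔ ((¬ Σ ℤ (λ k → Σ ℤ (λ l → (+ ∣ l ∣ ℤ.≤ k) × (+ n ≡ Q r p k l))))
          ⊎ (A 0 r p n ≡ A 1 r p n)))
    × (A 0 r p n > A 1 r p n → D (+ r) (2 * p) N > D (- (+ r)) (2 * p) N)
    × (A 0 r p n < A 1 r p n → D (+ r) (2 * p) N < D (- (+ r)) (2 * p) N)
corollary1p1 p r n 0<r r<p gcd≡1 =
  mk⇔ (λ D₊≡D₋ → inj₂ (trans A₀≡D₊ (trans D₊≡D₋ (sym A₁≡D₋))))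
      [ (λ ¬rep → trans (sym A₀≡D₊) (trans (A-unrepresented 0 r p n ¬rep)
                                            (trans (sym (A-unrepresented 1 r p n ¬rep)) A₁≡D₋)))
      , (λ A₀≡A₁ → trans (sym A₀≡D₊) (trans A₀≡A₁ A₁≡D₋)) ]
  , subst₂ _>_ A₀≡D₊ A₁≡D₋
  , subst₂ _<_ A₀≡D₊ A₁≡D₋
  where
  N : ℕ
  N = 2 * p * n + r * (p ∸ r)
  A₀≡D₊ : A 0 r p n ≡ D (+ r) (2 * p) N
  A₀≡D₊ = proj₁ (A≡D n 0<r r<p (gcd≡1⇒coprime gcd≡1))
  A₁≡D₋ : A 1 r p n ≡ D (- (+ r)) (2 * p) N
  A₁≡D₋ = proj₂ (A≡D n 0<r r<p (gcd≡1⇒coprime gcd≡1))
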